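{- Let $S=\{s_1,s_2\}$ with $1<s_1<s_2$ integers and $\gcd(s_1,s_2)=1$. Then $S$ is greedy, i.e. $\mathrm{GreedyCost}_S(k)=\mathrm{MinCost}_S(k)$ for all $k\in\langle S\rangle$, $k>0$.
   Context: $\langle S\rangle=\{a_1s_1+a_2s_2 : a_1,a_2\in\mathbb{N}_0\}$. A representation of $k\in\langle S\rangle$ is a vector $(a_1,a_2)\in\mathbb{N}_0^2$ with $a_1s_1+a_2s_2=k$; its cost is $a_1+a_2$; $\mathrm{MinCost}_S(k)$ is the minimum cost over all representations. The (generalized) greedy representation of $k$: let $a_2$ be the largest integer $q\ge0$ with $k-qs_2\in\langle S\rangle$, then $a_1=(k-a_2s_2)/s_1$; $\mathrm{GreedyCost}_S(k)=a_1+a_2$. -}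

module Defs where

open import Data.Nat using (ℕ; _+_; _*_; _≤_)
open import Data.Product using (Σ; ∃; _×_; _,_)
open import Relation.Binary.PropositionalEquality using (_≡_)

IsRep : ℕ → ℕ → ℕ → ℕ × ℕ → Set
IsRep s₁ s₂ k (a₁ , a₂) = a₁ * s₁ + a₂ * s₂ ≡ k

InSemigroup : ℕ → ℕ → ℕ → Set
InSemigroup s₁ s₂ k = Σ (ℕ × ℕ) (IsRep s₁ s₂ k)

cost : ℕ × ℕ → ℕ
cost (a₁ , a₂) = a₁ + a₂

IsMinCost : ℕ → ℕ → ℕ → ℕ → Set
IsMinCost s₁ s₂ k c =
  (Σ (ℕ × ℕ) λ a → IsRep s₁ s₂ k a × cost a ≡ c)
  × (∀ b → IsRep s₁ s₂ k b → c ≤ cost b)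

-- The (generalized) greedy representation (a₁ , a₂) of k:
-- a₂ is the largest q with k - q s₂ ∈ ⟨S⟩ (i.e. q s₂ + m = k for some m ∈ ⟨S⟩),
-- and a₁ = (k - a₂ s₂) / s₁, i.e. a₁ s₁ + a₂ s₂ = k.
IsGreedyRep : ℕ → ℕ → ℕ → ℕ × ℕ → Set
IsGreedyRep s₁ s₂ k (a₁ , a₂) =
  (a₁ * s₁ + a₂ * s₂ ≡ k)
  × (∀ q m → q * s₂ + m ≡ k → InSemigroup s₁ s₂ m → q ≤ a₂)

IsGreedyCost : ℕ → ℕ → ℕ → ℕ → Set
IsGreedyCost s₁ s₂ k c = Σ (ℕ × ℕ) λ a → IsGreedyRep s₁ s₂ k a × cost a ≡ c

{-# OPTIONS --safe #-}
module Submission where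

-- If (b₁ , b₂) represents k, then k − b₂s₂ = b₁s₁ lies in ⟨S⟩, so the greedy
-- representation (a₁ , a₂) has a₂ = b₂ + d for some d. Cancelling b₂s₂ gives
-- a₁s₁ + ds₂ = b₁s₁, and since s₁ ≤ s₂ this forces (a₁ + d)s₁ ≤ b₁s₁, i.e.
-- a₁ + a₂ ≤ b₁ + b₂.

open import Defs
open import Data.Nat using (ℕ; _<_; _≤_; _+_; _*_; NonZero; >-nonZero; z<s)
open import Data.Nat.Properties
open import Data.Nat.GCD using (gcd)
open import Data.Nat.Tactic.RingSolver using (solve-∀)
open import Data.Product using (_,_; proj₂)
open import Relation.Binary.PropositionalEquality using (_≡_; refl; sym; trans; cong; subst)

greedyRep-proj₂-maximal : ∀ {s₁ s₂ k} a b → IsGreedyRep s₁ s₂ k a → IsRep s₁ s₂ k b →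
  proj₂ b ≤ proj₂ a
greedyRep-proj₂-maximal {s₁} {s₂} _ (b₁ , b₂) (_ , maximal) b-rep =
  maximal b₂ (b₁ * s₁) (trans (+-comm (b₂ * s₂) (b₁ * s₁)) b-rep) ((b₁ , 0) , +-identityʳ (b₁ * s₁))

cost-antitone-proj₂ : ∀ {s₁ s₂ k} .{{_ : NonZero s₁}} → s₁ ≤ s₂ → ∀ a b →
  IsRep s₁ s₂ k a → IsRep s₁ s₂ k b → proj₂ b ≤ proj₂ a → cost a ≤ cost b
cost-antitone-proj₂ {s₁} {s₂} s₁≤s₂ (a₁ , a₂) (b₁ , b₂) a-rep b-rep b₂≤a₂
  with d , refl ← m≤n⇒∃[o]m+o≡n b₂≤a₂ = begin
    a₁ + (b₂ + d)  ≡⟨ cong (a₁ +_) (+-comm b₂ d) ⟩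
    a₁ + (d + b₂)  ≡⟨ +-assoc a₁ d b₂ ⟨
    (a₁ + d) + b₂  ≤⟨ +-monoˡ-≤ b₂ a₁+d≤b₁ ⟩
    b₁ + b₂        ∎
  where
  open ≤-Reasoning

  rearranged : ∀ a₁ b₂ d s₁ s₂ → a₁ * s₁ + (b₂ + d) * s₂ ≡ (a₁ * s₁ + d * s₂) + b₂ * s₂
  rearranged = solve-∀

  exchange : a₁ * s₁ + d * s₂ ≡ b₁ * s₁
  exchange = +-cancelʳ-≡ (b₂ * s₂) _ _ (trans (sym (rearranged a₁ b₂ d s₁ s₂)) (trans a-rep (sym b-rep)))

  a₁+d≤b₁ : a₁ + d ≤ b₁
  a₁+d≤b₁ = *-cancelʳ-≤ (a₁ + d) b₁ s₁ (begin
    (a₁ + d) * s₁      ≡⟨ *-distribʳ-+ s₁ a₁ d ⟩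
    a₁ * s₁ + d * s₁   ≤⟨ +-monoʳ-≤ (a₁ * s₁) (*-monoʳ-≤ d s₁≤s₂) ⟩
    a₁ * s₁ + d * s₂   ≡⟨ exchange ⟩
    b₁ * s₁            ∎)

proposition3 : (s₁ s₂ : ℕ) → 1 < s₁ → s₁ < s₂ → gcd s₁ s₂ ≡ 1 →
    (k : ℕ) → InSemigroup s₁ s₂ k → 0 < k →
    (c : ℕ) → IsGreedyCost s₁ s₂ k c → IsMinCost s₁ s₂ k c
proposition3 s₁ s₂ 1<s₁ s₁<s₂ _ k _ _ c (a , greedy@(a-rep , _) , cost-a≡c) =
  (a , a-rep , cost-a≡c) , minimal
  where
  instance
    s₁-nonZero : NonZero s₁
    s₁-nonZero = >-nonZero (<-trans z<s 1<s₁)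

  minimal : ∀ b → IsRep s₁ s₂ k b → c ≤ cost b
  minimal b b-rep = subst (_≤ cost b) cost-a≡c
    (cost-antitone-proj₂ (<⇒≤ s₁<s₂) a b a-rep b-rep (greedyRep-proj₂-maximal a b greedy b-rep))
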